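{- Let $q$ be a prime power. Any two Peisert-type graphs of type $(3,q)$ are isomorphic.
   Context: For an abelian group $G$ and $S\subseteq G\setminus\{0\}$ with $S=-S$, $\operatorname{Cay}(G,S)$ is the graph on $G$ with $g\sim h$ iff $g-h\in S$. A Peisert-type graph of type $(m,q)$ is $\operatorname{Cay}(\mathbb{F}_{q^2}^+,S)$ where $S=c_1\mathbb{F}_q^*\cup\cdots\cup c_m\mathbb{F}_q^*$ is a union of $m\le q$ distinct cosets of $\mathbb{F}_q^*$ in $\mathbb{F}_{q^2}^*$. -}

module Defs where

open import Level using (0ℓ)
open import Data.Nat using (ℕ; suc; _^_; _≤_)
open import Data.Nat.Primality using (Prime)
open import Data.Fin using (Fin)
open import Data.Product using (Σ; ∃; _×_; _,_)
open import Relation.Binary.PropositionalEquality using (_≡_; _≢_)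
open import Relation.Nullary using (¬_)
open import Algebra.Core using (Op₁; Op₂)
open import Algebra.Structures using (IsCommutativeRing)
open import Function.Bundles using (_↔_; Inverse)
open import Function.Definitions using (Injective)

IsPrimePower : ℕ → Set
IsPrimePower q = ∃ λ p → ∃ λ k → Prime p × q ≡ p ^ suc k

record Field : Set₁ where
  infixl 7 _*_
  infixl 6 _+_
  field
    Carrier : Set
    _+_ _*_ : Op₂ Carrier
    -_ : Op₁ Carrier
    0# 1# : Carrier
    isCommutativeRing : IsCommutativeRing _≡_ _+_ _*_ -_ 0# 1#
    0≢1 : 0# ≢ 1#
    inverse : ∀ x → x ≢ 0# → ∃ λ y → x * y ≡ 1#

  _-_ : Op₂ Carrier
  x - y = x + (- y)

HasOrder : Field → ℕ → Set
HasOrder K n = Field.Carrier K ↔ Fin n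

record FieldEmbedding (F K : Field) : Set where
  module F = Field F
  module K = Field K
  field
    ι : F.Carrier → K.Carrier
    ι-+ : ∀ a b → ι (a F.+ b) ≡ ι a K.+ ι b
    ι-* : ∀ a b → ι (a F.* b) ≡ ι a K.* ι b
    ι-1 : ι F.1# ≡ K.1#
    ι-injective : Injective _≡_ _≡_ ι

-- Setting: K = F_{q^2}, with the subfield F_q given as the image of an embedding
record Setting (q : ℕ) : Set₁ where
  field
    Fq Fq² : Field
    order-Fq : HasOrder Fq q
    order-Fq² : HasOrder Fq² (q ^ 2)
    emb : FieldEmbedding Fq Fq²

module _ {q : ℕ} (𝕊 : Setting q) where
  open Setting 𝕊
  private
    module F = Field Fq
    module K = Field Fq²
  open FieldEmbedding emb using (ι)

  InCoset : K.Carrier → K.Carrier → Set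
  InCoset c x = ∃ λ (a : F.Carrier) → a ≢ F.0# × x ≡ c K.* ι a

  -- data for a Peisert-type graph of type (m,q): m distinct cosets
  -- c_1 F_q^*, ..., c_m F_q^* of F_q^* in F_{q^2}^*, with m ≤ q
  record PeisertData (m : ℕ) : Set where
    field
      m≤q : m ≤ q
      c : Fin m → K.Carrier
      c-nonzero : ∀ i → c i ≢ K.0#
      cosets-distinct : ∀ i j → ¬ (i ≡ j) → ¬ (∀ x → (InCoset (c i) x → InCoset (c j) x) × (InCoset (c j) x → InCoset (c i) x))

  ConnSet : ∀ {m} → PeisertData m → K.Carrier → Set
  ConnSet P x = ∃ λ i → InCoset (PeisertData.c P i) x

  Adj : ∀ {m} → PeisertData m → K.Carrier → K.Carrier → Set
  Adj P g h = ConnSet P (g K.- h)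

  record GraphIso {m m' : ℕ} (P : PeisertData m) (P' : PeisertData m') : Set where
    field
      φ : K.Carrier ↔ K.Carrier
    open Inverse φ using (to)
    field
      preserves : ∀ g h → Adj P g h → Adj P' (to g) (to h)
      reflects  : ∀ g h → Adj P' (to g) (to h) → Adj P g h

module Submission where

-- F_{q²} is a 2-dimensional F_q-vector space, and three pairwise non-proportional
-- vectors c₀, c₁, c₂ in it can be rescaled within their F_q^*-cosets to u, v, u + v:
-- write c₂ = α c₀ + β c₁ (α, β ≠ 0 by non-proportionality) and take u = α c₀,
-- v = β c₁. For two such data the F_q-linear map sending u ↦ u′, v ↦ v′ is an
-- additive bijection carrying each coset of the first connection set onto the
-- corresponding coset of the second, hence a Cayley graph isomorphism. That
-- (u, v) is a basis comes from counting: the coordinate map F_q² → F_{q²} is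
-- injective, and both sides have q² elements.

open import Level using (0ℓ)
open import Data.Nat using (ℕ; suc; _^_)
import Data.Nat as ℕ
open import Data.Nat.Properties using (n<1+n; *-identityʳ)
open import Data.Fin using (Fin; zero; suc; punchOut)
open import Data.Fin.Properties using (pigeonhole; punchOut-injective; any?; <⇒≢; *↔×)
  renaming (_≟_ to _≟ᶠ_)
open import Data.Product using (_×_; _,_; proj₁; proj₂)
open import Data.Product.Function.NonDependent.Propositional using (_×-↔_)
open import Data.Empty using (⊥-elim)
open import Function.Base using (_∘_; id)
open import Function.Definitions using (Injective; StrictlySurjective)
open import Function.Bundles using (_↔_; Inverse; Injection; mk⤖)
open import Function.Properties.Bijection using (⤖⇒↔)
open import Function.Properties.Inverse using (↔⇒↣; ↔-sym; ↔-trans)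
open import Function.Consequences.Propositional using (strictlySurjective⇒surjective)
open import Relation.Nullary using (yes; no)
open import Relation.Nullary.Decidable using (via-injection)
open import Relation.Binary.Definitions using (DecidableEquality)
open import Relation.Binary.PropositionalEquality
open import Algebra.Bundles using (CommutativeRing)
open import Algebra.Structures using (IsCommutativeRing)
import Algebra.Properties.Ring as RingProperties
import Algebra.Properties.AbelianGroup as AbelianGroupProperties
import Algebra.Properties.CommutativeSemigroup as CommutativeSemigroupProperties
open import Defs

injective⇒strictlySurjective : ∀ {n} (f : Fin n → Fin n) →
  Injective _≡_ _≡_ f → StrictlySurjective _≡_ f
injective⇒strictlySurjective {suc n} f f-inj y with any? (λ x → f x ≟ᶠ y)
... | yes hit = hit
... | no miss =
  let i , j , i<j , squeeze[i]≡squeeze[j] = pigeonhole (n<1+n n) squeeze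
  in ⊥-elim (<⇒≢ i<j (f-inj (punchOut-injective {i = y} _ _ squeeze[i]≡squeeze[j])))
  where
  squeeze : Fin (suc n) → Fin n
  squeeze x = punchOut (λ y≡fx → miss (x , sym y≡fx))

module _ {A B : Set} {n : ℕ} (A↔Fin : A ↔ Fin n) (B↔Fin : B ↔ Fin n) where
  private
    module A = Inverse A↔Fin
    module B = Inverse B↔Fin

  injective⇒↔ : (f : A → B) → Injective _≡_ _≡_ f → A ↔ B
  injective⇒↔ f f-inj = ⤖⇒↔ (mk⤖ (f-inj , strictlySurjective⇒surjective f-surj))
    where
    to-inj : Injective _≡_ _≡_ B.to
    to-inj = Injection.injective (↔⇒↣ B↔Fin)
    from-inj : Injective _≡_ _≡_ A.from
    from-inj = Injection.injective (↔⇒↣ (↔-sym A↔Fin))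
    f-surj : StrictlySurjective _≡_ f
    f-surj y =
      let k , k↦y = injective⇒strictlySurjective (B.to ∘ f ∘ A.from)
                      (from-inj ∘ f-inj ∘ to-inj) (B.to y)
      in A.from k , to-inj k↦y

module FieldProperties (K : Field) where
  open Field K public
  open IsCommutativeRing isCommutativeRing public
    using (+-identityˡ; +-identityʳ; -‿inverseʳ;
           *-assoc; *-comm; *-identityˡ; *-identityʳ; distribˡ; distribʳ; zeroʳ)

  commutativeRing : CommutativeRing 0ℓ 0ℓ
  commutativeRing = record { isCommutativeRing = isCommutativeRing }

  open CommutativeRing commutativeRing using (ring; +-abelianGroup; +-commutativeSemigroup)
  open CommutativeSemigroupProperties +-commutativeSemigroup public using (interchange)
  open RingProperties ring public using (x+x≈x⇒x≈0; -‿distribˡ-*; -‿distribʳ-*)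
  open AbelianGroupProperties +-abelianGroup public
    using (identityˡ-unique; inverseʳ-unique; x∙y⁻¹≈ε⇒x≈y; //-rightDividesˡ; x≈z//y)
  open ≡-Reasoning

  +-homo⇒-homo : (f : Carrier → Carrier) → (∀ x y → f (x + y) ≡ f x + f y) →
    ∀ x y → f (x - y) ≡ f x - f y
  +-homo⇒-homo f f-+ x y = x≈z//y (f (x - y)) (f y) (f x)
    (trans (sym (f-+ (x - y) y)) (cong f (//-rightDividesˡ y x)))

  inv : ∀ x → x ≢ 0# → Carrier
  inv x x≢0 = proj₁ (inverse x x≢0)

  *-inverseʳ : ∀ x (x≢0 : x ≢ 0#) → x * inv x x≢0 ≡ 1#
  *-inverseʳ x x≢0 = proj₂ (inverse x x≢0)

  *-inverse-cancelˡ : ∀ x (x≢0 : x ≢ 0#) y → x * (inv x x≢0 * y) ≡ y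
  *-inverse-cancelˡ x x≢0 y = begin
    x * (inv x x≢0 * y)  ≡⟨ *-assoc x _ y ⟨
    x * inv x x≢0 * y    ≡⟨ cong (_* y) (*-inverseʳ x x≢0) ⟩
    1# * y               ≡⟨ *-identityˡ y ⟩
    y                    ∎

  *-cancelˡ-≢0 : ∀ {x y z} → x ≢ 0# → x * y ≡ x * z → y ≡ z
  *-cancelˡ-≢0 {x} {y} {z} x≢0 xy≡xz = begin
    y                    ≡⟨ *-inverse-cancelˡ x x≢0 y ⟨
    x * (inv x x≢0 * y)  ≡⟨ cong (x *_) (*-comm _ y) ⟩
    x * (y * inv x x≢0)  ≡⟨ *-assoc x y _ ⟨
    x * y * inv x x≢0    ≡⟨ cong (_* inv x x≢0) xy≡xz ⟩
    x * z * inv x x≢0    ≡⟨ *-assoc x z _ ⟩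
    x * (z * inv x x≢0)  ≡⟨ cong (x *_) (*-comm z _) ⟩
    x * (inv x x≢0 * z)  ≡⟨ *-inverse-cancelˡ x x≢0 z ⟩
    z                    ∎

  *-≡0⇒≡0 : ∀ {x y} → x ≢ 0# → x * y ≡ 0# → y ≡ 0#
  *-≡0⇒≡0 {x} x≢0 xy≡0 = *-cancelˡ-≢0 x≢0 (trans xy≡0 (sym (zeroʳ x)))

  *-≢0 : ∀ {x y} → x ≢ 0# → y ≢ 0# → x * y ≢ 0#
  *-≢0 x≢0 y≢0 xy≡0 = y≢0 (*-≡0⇒≡0 x≢0 xy≡0)

  inv-≢0 : ∀ x (x≢0 : x ≢ 0#) → inv x x≢0 ≢ 0#
  inv-≢0 x x≢0 x⁻¹≡0 = 0≢1 (begin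
    0#             ≡⟨ zeroʳ x ⟨
    x * 0#         ≡⟨ cong (x *_) x⁻¹≡0 ⟨
    x * inv x x≢0  ≡⟨ *-inverseʳ x x≢0 ⟩
    1#             ∎)

module VectorSpace {F K : Field} (emb : FieldEmbedding F K) where
  private
    module F = FieldProperties F
    module K = FieldProperties K
  open FieldEmbedding emb using (ι; ι-+; ι-*; ι-1; ι-injective)
  open ≡-Reasoning

  ι-0 : ι F.0# ≡ K.0#
  ι-0 = K.x+x≈x⇒x≈0 (ι F.0#) (trans (sym (ι-+ F.0# F.0#)) (cong ι (F.+-identityʳ F.0#)))

  ι-‿ : ∀ a → ι (F.- a) ≡ K.- ι a
  ι-‿ a = K.inverseʳ-unique (ι a) (ι (F.- a))
    (trans (sym (ι-+ a (F.- a))) (trans (cong ι (F.-‿inverseʳ a)) ι-0))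

  infixl 7 _·_
  _·_ : K.Carrier → F.Carrier → K.Carrier
  v · a = v K.* ι a

  ·-distribˡ : ∀ v a b → v · (a F.+ b) ≡ v · a K.+ v · b
  ·-distribˡ v a b = trans (cong (v K.*_) (ι-+ a b)) (K.distribˡ v (ι a) (ι b))

  ·-distribʳ : ∀ u v a → (u K.+ v) · a ≡ u · a K.+ v · a
  ·-distribʳ u v a = K.distribʳ (ι a) u v

  ·-assoc : ∀ v a b → v · a · b ≡ v · (a F.* b)
  ·-assoc v a b = trans (K.*-assoc v (ι a) (ι b)) (cong (v K.*_) (sym (ι-* a b)))

  ·-identityʳ : ∀ v → v · F.1# ≡ v
  ·-identityʳ v = trans (cong (v K.*_) ι-1) (K.*-identityʳ v)

  ·-zeroʳ : ∀ v → v · F.0# ≡ K.0#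
  ·-zeroʳ v = trans (cong (v K.*_) ι-0) (K.zeroʳ v)

  ·-‿ : ∀ v a → v · (F.- a) ≡ K.- (v · a)
  ·-‿ v a = trans (cong (v K.*_) (ι-‿ a)) (sym (K.-‿distribʳ-* v (ι a)))

  ·-cancelˡ : ∀ {v a b} → v ≢ K.0# → v · a ≡ v · b → a ≡ b
  ·-cancelˡ v≢0 va≡vb = ι-injective (K.*-cancelˡ-≢0 v≢0 va≡vb)

  Independent : K.Carrier → K.Carrier → Set
  Independent u v = ∀ x y → u · x K.+ v · y ≡ K.0# → x ≡ F.0# × y ≡ F.0#

  non-proportional⇒independent : DecidableEquality F.Carrier → ∀ {u v} →
    u ≢ K.0# → (∀ a → v ≢ u · a) → Independent u v
  non-proportional⇒independent _≟_ {u} {v} u≢0 v∉uF x y ux+vy≡0 with y ≟ F.0#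
  ... | yes refl = ·-cancelˡ u≢0 ux≡u0 , refl
    where
    ux≡u0 : u · x ≡ u · F.0#
    ux≡u0 = begin
      u · x                   ≡⟨ K.+-identityʳ (u · x) ⟨
      u · x K.+ K.0#          ≡⟨ cong (u · x K.+_) (·-zeroʳ v) ⟨
      u · x K.+ v · F.0#      ≡⟨ ux+vy≡0 ⟩
      K.0#                    ≡⟨ ·-zeroʳ u ⟨
      u · F.0#                ∎
  ... | no y≢0 = ⊥-elim (v∉uF (F.- (x F.* y⁻¹)) (begin
      v                       ≡⟨ ·-identityʳ v ⟨
      v · F.1#                ≡⟨ cong (v ·_) (F.*-inverseʳ y y≢0) ⟨
      v · (y F.* y⁻¹)         ≡⟨ ·-assoc v y y⁻¹ ⟨
      v · y · y⁻¹             ≡⟨ cong (_· y⁻¹) (K.inverseʳ-unique (u · x) (v · y) ux+vy≡0) ⟩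
      K.- (u · x) · y⁻¹       ≡⟨ K.-‿distribˡ-* (u · x) (ι y⁻¹) ⟨
      K.- (u · x · y⁻¹)       ≡⟨ cong K.-_ (·-assoc u x y⁻¹) ⟩
      K.- (u · (x F.* y⁻¹))   ≡⟨ ·-‿ u (x F.* y⁻¹) ⟨
      u · F.- (x F.* y⁻¹)     ∎))
    where
    y⁻¹ : F.Carrier
    y⁻¹ = F.inv y y≢0

  coord : K.Carrier → K.Carrier → F.Carrier × F.Carrier → K.Carrier
  coord u v (x , y) = u · x K.+ v · y

  coord-+ : ∀ u v x y x′ y′ →
    coord u v (x F.+ x′ , y F.+ y′) ≡ coord u v (x , y) K.+ coord u v (x′ , y′)
  coord-+ u v x y x′ y′ = begin
    u · (x F.+ x′) K.+ v · (y F.+ y′)                  ≡⟨ cong₂ K._+_ (·-distribˡ u x x′) (·-distribˡ v y y′) ⟩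
    (u · x K.+ u · x′) K.+ (v · y K.+ v · y′)          ≡⟨ K.interchange (u · x) (u · x′) (v · y) (v · y′) ⟩
    (u · x K.+ v · y) K.+ (u · x′ K.+ v · y′)          ∎

  coord-injective : ∀ {u v} → Independent u v → Injective _≡_ _≡_ (coord u v)
  coord-injective {u} {v} u,v-indep {x , y} {x′ , y′} same-coord =
    let x-x′≡0 , y-y′≡0 = u,v-indep _ _ difference-vanishes
    in cong₂ _,_ (F.x∙y⁻¹≈ε⇒x≈y x x′ x-x′≡0) (F.x∙y⁻¹≈ε⇒x≈y y y′ y-y′≡0)
    where
    difference-vanishes : coord u v (x F.- x′ , y F.- y′) ≡ K.0#
    difference-vanishes = K.identityˡ-unique _ (coord u v (x′ , y′)) (begin
      coord u v (x F.- x′ , y F.- y′) K.+ coord u v (x′ , y′)   ≡⟨ coord-+ u v _ _ x′ y′ ⟨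
      coord u v (x F.- x′ F.+ x′ , y F.- y′ F.+ y′)             ≡⟨ cong₂ (λ a b → coord u v (a , b)) (F.//-rightDividesˡ x′ x) (F.//-rightDividesˡ y′ y) ⟩
      coord u v (x , y)                                         ≡⟨ same-coord ⟩
      coord u v (x′ , y′)                                       ∎)

  independent-· : ∀ {u v a b} → a ≢ F.0# → b ≢ F.0# →
    Independent u v → Independent (u · a) (v · b)
  independent-· {u} {v} {a} {b} a≢0 b≢0 u,v-indep x y uax+vby≡0 =
    let ax≡0 , by≡0 = u,v-indep (a F.* x) (b F.* y)
                        (trans (sym (cong₂ K._+_ (·-assoc u a x) (·-assoc v b y))) uax+vby≡0)
    in F.*-≡0⇒≡0 a≢0 ax≡0 , F.*-≡0⇒≡0 b≢0 by≡0

module PeisertGraphs {q : ℕ} (𝕊 : Setting q) where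
  open Setting 𝕊
  private
    module F = FieldProperties Fq
    module K = FieldProperties Fq²
  open VectorSpace emb
  open ≡-Reasoning

  _≟_ : DecidableEquality F.Carrier
  _≟_ = via-injection (↔⇒↣ order-Fq) _≟ᶠ_

  F²↔Fin : (F.Carrier × F.Carrier) ↔ Fin (q ^ 2)
  F²↔Fin = subst (λ n → (F.Carrier × F.Carrier) ↔ Fin n) (cong (q ℕ.*_) (sym (*-identityʳ q)))
    (↔-trans (order-Fq ×-↔ order-Fq) (↔-sym *↔×))

  coordinates : ∀ {u v} → Independent u v → (F.Carrier × F.Carrier) ↔ K.Carrier
  coordinates {u} {v} u,v-indep = injective⇒↔ F²↔Fin order-Fq² (coord u v) (coord-injective u,v-indep)

  SameCoset : K.Carrier → K.Carrier → Set
  SameCoset c d = ∀ x → (InCoset 𝕊 c x → InCoset 𝕊 d x) × (InCoset 𝕊 d x → InCoset 𝕊 c x)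

  sameCoset-refl : ∀ c → SameCoset c c
  sameCoset-refl c x = id , id

  sameCoset-· : ∀ c {a} → a ≢ F.0# → SameCoset c (c · a)
  sameCoset-· c {a} a≢0 x = to , from
    where
    a⁻¹ : F.Carrier
    a⁻¹ = F.inv a a≢0
    to : InCoset 𝕊 c x → InCoset 𝕊 (c · a) x
    to (b , b≢0 , x≡cb) = a⁻¹ F.* b , F.*-≢0 (F.inv-≢0 a a≢0) b≢0 , (begin
      x                    ≡⟨ x≡cb ⟩
      c · b                ≡⟨ cong (c ·_) (F.*-inverse-cancelˡ a a≢0 b) ⟨
      c · (a F.* (a⁻¹ F.* b)) ≡⟨ ·-assoc c a _ ⟨
      c · a · (a⁻¹ F.* b)  ∎)
    from : InCoset 𝕊 (c · a) x → InCoset 𝕊 c x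
    from (b , b≢0 , x≡cab) = a F.* b , F.*-≢0 a≢0 b≢0 , trans x≡cab (·-assoc c a b)

  normalTriple : K.Carrier → K.Carrier → Fin 3 → K.Carrier
  normalTriple u v zero = u
  normalTriple u v (suc zero) = v
  normalTriple u v (suc (suc zero)) = u K.+ v

  normalCoords : Fin 3 → F.Carrier → F.Carrier × F.Carrier
  normalCoords zero s = s , F.0#
  normalCoords (suc zero) s = F.0# , s
  normalCoords (suc (suc zero)) s = s , s

  normalTriple-·-coord : ∀ u v i s → normalTriple u v i · s ≡ coord u v (normalCoords i s)
  normalTriple-·-coord u v zero s = begin
    u · s                  ≡⟨ K.+-identityʳ (u · s) ⟨
    u · s K.+ K.0#         ≡⟨ cong (u · s K.+_) (·-zeroʳ v) ⟨
    u · s K.+ v · F.0#     ∎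
  normalTriple-·-coord u v (suc zero) s = begin
    v · s                  ≡⟨ K.+-identityˡ (v · s) ⟨
    K.0# K.+ v · s         ≡⟨ cong (K._+ v · s) (·-zeroʳ u) ⟨
    u · F.0# K.+ v · s     ∎
  normalTriple-·-coord u v (suc (suc zero)) s = ·-distribʳ u v s

  record NormalForm (P : PeisertData 𝕊 3) : Set where
    field
      u v : K.Carrier
      independent : Independent u v
      sameCosets : ∀ i → SameCoset (PeisertData.c P i) (normalTriple u v i)

  normalForm : (P : PeisertData 𝕊 3) → NormalForm P
  normalForm P = record
    { u = c₀ · α
    ; v = c₁ · β
    ; independent = independent-· α≢0 β≢0 c₀,c₁-independent
    ; sameCosets = λ where
        zero → sameCoset-· c₀ α≢0
        (suc zero) → sameCoset-· c₁ β≢0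
        (suc (suc zero)) → subst (SameCoset c₂) c₂≡c₀α+c₁β (sameCoset-refl c₂)
    }
    where
    open PeisertData P
    c₀ c₁ c₂ : K.Carrier
    c₀ = c zero
    c₁ = c (suc zero)
    c₂ = c (suc (suc zero))

    non-proportional : ∀ i j → i ≢ j → ∀ a → c j ≢ c i · a
    non-proportional i j i≢j a cj≡cia with a ≟ F.0#
    ... | yes refl = c-nonzero j (trans cj≡cia (·-zeroʳ (c i)))
    ... | no a≢0 = cosets-distinct i j i≢j (subst (SameCoset (c i)) (sym cj≡cia) (sameCoset-· (c i) a≢0))

    c₀,c₁-independent : Independent c₀ c₁
    c₀,c₁-independent = non-proportional⇒independent _≟_ (c-nonzero zero) (non-proportional zero (suc zero) λ ())

    α β : F.Carrier
    α = proj₁ (Inverse.from (coordinates c₀,c₁-independent) c₂)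
    β = proj₂ (Inverse.from (coordinates c₀,c₁-independent) c₂)

    c₂≡c₀α+c₁β : c₂ ≡ c₀ · α K.+ c₁ · β
    c₂≡c₀α+c₁β = sym (Inverse.strictlyInverseˡ (coordinates c₀,c₁-independent) c₂)

    α≢0 : α ≢ F.0#
    α≢0 α≡0 = non-proportional (suc zero) (suc (suc zero)) (λ ()) β (begin
      c₂                          ≡⟨ c₂≡c₀α+c₁β ⟩
      c₀ · α K.+ c₁ · β           ≡⟨ cong (λ a → c₀ · a K.+ c₁ · β) α≡0 ⟩
      c₀ · F.0# K.+ c₁ · β        ≡⟨ cong (K._+ c₁ · β) (·-zeroʳ c₀) ⟩
      K.0# K.+ c₁ · β             ≡⟨ K.+-identityˡ (c₁ · β) ⟩
      c₁ · β                      ∎)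

    β≢0 : β ≢ F.0#
    β≢0 β≡0 = non-proportional zero (suc (suc zero)) (λ ()) α (begin
      c₂                          ≡⟨ c₂≡c₀α+c₁β ⟩
      c₀ · α K.+ c₁ · β           ≡⟨ cong (λ b → c₀ · α K.+ c₁ · b) β≡0 ⟩
      c₀ · α K.+ c₁ · F.0#        ≡⟨ cong (c₀ · α K.+_) (·-zeroʳ c₁) ⟩
      c₀ · α K.+ K.0#             ≡⟨ K.+-identityʳ (c₀ · α) ⟩
      c₀ · α                      ∎)

  additive-bijection⇒GraphIso : ∀ {m m′} {P : PeisertData 𝕊 m} {P′ : PeisertData 𝕊 m′}
    (φ : K.Carrier ↔ K.Carrier) → let open Inverse φ using (to) in
    (∀ g h → to (g K.+ h) ≡ to g K.+ to h) →
    (∀ x → ConnSet 𝕊 P x → ConnSet 𝕊 P′ (to x)) →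
    (∀ x → ConnSet 𝕊 P′ (to x) → ConnSet 𝕊 P x) →
    GraphIso 𝕊 P P′
  additive-bijection⇒GraphIso {P = P} {P′} φ φ-+ φ-maps φ-reflects = record
    { φ = φ
    ; preserves = λ g h g~h → subst (ConnSet 𝕊 P′) (φ-‿ g h) (φ-maps (g K.- h) g~h)
    ; reflects = λ g h φg~φh → φ-reflects (g K.- h) (subst (ConnSet 𝕊 P′) (sym (φ-‿ g h)) φg~φh)
    }
    where
    open Inverse φ using (to)
    φ-‿ : ∀ g h → to (g K.- h) ≡ to g K.- to h
    φ-‿ = K.+-homo⇒-homo to φ-+

  module _ {P P′ : PeisertData 𝕊 3} (N : NormalForm P) (N′ : NormalForm P′) where
    private
      module N = NormalForm N
      module N′ = NormalForm N′

    φ : K.Carrier ↔ K.Carrier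
    φ = ↔-trans (↔-sym (coordinates N.independent)) (coordinates N′.independent)

    open Inverse φ using (to)

    φ-coord : ∀ p → to (coord N.u N.v p) ≡ coord N′.u N′.v p
    φ-coord p = cong (coord N′.u N′.v) (Inverse.strictlyInverseʳ (coordinates N.independent) p)

    φ-coord-+ : ∀ p r → to (coord N.u N.v p K.+ coord N.u N.v r) ≡
                        to (coord N.u N.v p) K.+ to (coord N.u N.v r)
    φ-coord-+ (x , y) (x′ , y′) = begin
      to (coord N.u N.v (x , y) K.+ coord N.u N.v (x′ , y′))    ≡⟨ cong to (coord-+ N.u N.v x y x′ y′) ⟨
      to (coord N.u N.v (x F.+ x′ , y F.+ y′))                  ≡⟨ φ-coord _ ⟩
      coord N′.u N′.v (x F.+ x′ , y F.+ y′)                     ≡⟨ coord-+ N′.u N′.v x y x′ y′ ⟩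
      coord N′.u N′.v (x , y) K.+ coord N′.u N′.v (x′ , y′)     ≡⟨ cong₂ K._+_ (φ-coord _) (φ-coord _) ⟨
      to (coord N.u N.v (x , y)) K.+ to (coord N.u N.v (x′ , y′)) ∎

    φ-+ : ∀ g h → to (g K.+ h) ≡ to g K.+ to h
    φ-+ g h =
      subst₂ (λ a b → to (a K.+ b) ≡ to a K.+ to b) (coords-of g) (coords-of h)
        (φ-coord-+ (Inverse.from (coordinates N.independent) g) (Inverse.from (coordinates N.independent) h))
      where
      coords-of : ∀ k → coord N.u N.v (Inverse.from (coordinates N.independent) k) ≡ k
      coords-of = Inverse.strictlyInverseˡ (coordinates N.independent)

    φ-normalTriple : ∀ i s → to (normalTriple N.u N.v i · s) ≡ normalTriple N′.u N′.v i · s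
    φ-normalTriple i s = begin
      to (normalTriple N.u N.v i · s)           ≡⟨ cong to (normalTriple-·-coord N.u N.v i s) ⟩
      to (coord N.u N.v (normalCoords i s))     ≡⟨ φ-coord (normalCoords i s) ⟩
      coord N′.u N′.v (normalCoords i s)        ≡⟨ normalTriple-·-coord N′.u N′.v i s ⟨
      normalTriple N′.u N′.v i · s              ∎

    φ-maps : ∀ x → ConnSet 𝕊 P x → ConnSet 𝕊 P′ (to x)
    φ-maps x (i , x∈cᵢF*) =
      let s , s≢0 , x≡tᵢs = proj₁ (N.sameCosets i x) x∈cᵢF*
      in i , proj₂ (N′.sameCosets i (to x)) (s , s≢0 , trans (cong to x≡tᵢs) (φ-normalTriple i s))

    φ-reflects : ∀ x → ConnSet 𝕊 P′ (to x) → ConnSet 𝕊 P x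
    φ-reflects x (i , φx∈c′ᵢF*) =
      let s , s≢0 , φx≡t′ᵢs = proj₁ (N′.sameCosets i (to x)) φx∈c′ᵢF*
      in i , proj₂ (N.sameCosets i x)
               (s , s≢0 , Injection.injective (↔⇒↣ φ) (trans φx≡t′ᵢs (sym (φ-normalTriple i s))))

    normalForms⇒GraphIso : GraphIso 𝕊 P P′
    normalForms⇒GraphIso = additive-bijection⇒GraphIso φ φ-+ φ-maps φ-reflects

corollary3p3 : (q : ℕ) → IsPrimePower q → (𝕊 : Setting q) → (P P' : PeisertData 𝕊 3) → GraphIso 𝕊 P P'
corollary3p3 q _ 𝕊 P P' = normalForms⇒GraphIso (normalForm P) (normalForm P')
  where open PeisertGraphs 𝕊
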